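{- Let $M$ be a mutual-visibility set of $Q_h$ and let $u \in M$. Let $X = N[u] \cap M$, and let $Q$ be the sub-cube of $Q_h$ raised by $X$. Then $V(Q) \cap M = X$.
   Context: $Q_h$ is the hypercube with vertex set $\{0,1\}^h$, two strings adjacent iff they differ in exactly one position. $N(u)$ is the set of neighbours of $u$ and $N[u]=N(u)\cup\{u\}$. For $M \subseteq V(G)$, a $u,v$-path is $M$-free if it contains no vertex of $M\setminus\{u,v\}$; $u,v$ are $M$-visible if there is an $M$-free shortest $u,v$-path; $M$ is a mutual-visibility set if every two vertices of $M$ are $M$-visible. Sub-cube raised by $X$: if $X \setminus\{u\} \subseteq N(u)$ has $d \ge 1$ elements, let $w$ be the vertex of $Q_h$ at distance $d-1$ from every vertex of $X\setminus\{u\}$ (i.e. $w$ differs from $u$ exactly in the $d$ coordinates in which $u$ differs from the vertices of $X\setminus\{u\}$); the sub-cube raised by $X$ is the subgraph of $Q_h$ induced by the interval $I(u,w)$ (the set of vertices lying on shortest $u,w$-paths), which is a $d$-dimensional cube containing $X$. If $X=\{u\}$, the raised sub-cube is the single vertex $u$. -}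

module Defs where

open import Data.Nat using (ℕ; zero; suc; _≤_)
open import Data.Bool using (Bool)
open import Data.Fin using (Fin)
open import Data.Vec using (Vec; lookup)
open import Data.Product using (Σ; ∃; _×_; _,_)
open import Data.Sum using (_⊎_)
open import Relation.Binary.PropositionalEquality using (_≡_; _≢_)
open import Relation.Nullary using (¬_)

V : ℕ → Set
V h = Vec Bool h

Adj : ∀ {h} → V h → V h → Set
Adj {h} u v = Σ (Fin h) λ i → (lookup u i ≢ lookup v i) × (∀ j → j ≢ i → lookup u j ≡ lookup v j)

ClosedNbr : ∀ {h} → V h → V h → Set
ClosedNbr u x = (x ≡ u) ⊎ Adj u x

data Path {h : ℕ} : V h → V h → Set where
  [] : ∀ {u} → Path u u
  _∷_ : ∀ {u v w} → Adj u v → Path v w → Path u w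

length : ∀ {h} {u v : V h} → Path u v → ℕ
length [] = zero
length (_ ∷ p) = suc (length p)

data OnPath {h : ℕ} (z : V h) : {u v : V h} → Path u v → Set where
  here  : ∀ {v} {p : Path z v} → OnPath z p
  there : ∀ {u v w : V h} {a : Adj u v} {p : Path v w} → OnPath z p → OnPath z (_∷_ {u = u} {v = v} a p)

Shortest : ∀ {h} {u v : V h} → Path u v → Set
Shortest {u = u} {v} p = ∀ (q : Path u v) → length p ≤ length q

Free : ∀ {h} → (V h → Set) → {u v : V h} → Path u v → Set
Free M {u} {v} p = ∀ z → OnPath z p → z ≢ u → z ≢ v → ¬ M z

Visible : ∀ {h} → (V h → Set) → V h → V h → Set
Visible M u v = Σ (Path u v) λ p → Shortest p × Free M p

MutualVisibility : ∀ {h} → (V h → Set) → Set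
MutualVisibility M = ∀ x y → M x → M y → Visible M x y

Interval : ∀ {h} → V h → V h → V h → Set
Interval u w z = Σ (Path u w) λ p → Shortest p × OnPath z p

-- w is the apex of the sub-cube raised by X = N[u] ∩ M: w differs from u
-- exactly in those coordinates in which u differs from some vertex of X \ {u}
-- (= N(u) ∩ M). When X = {u} this forces w = u, so I(u,w) = {u}.
RaisedApex : ∀ {h} → (V h → Set) → V h → V h → Set
RaisedApex {h} M u w =
  ∀ (i : Fin h) →
    ((lookup w i ≢ lookup u i) → ∃ λ x → Adj u x × M x × (lookup x i ≢ lookup u i))
  × ((∃ λ x → Adj u x × M x × (lookup x i ≢ lookup u i)) → lookup w i ≢ lookup u i)

{-# OPTIONS --safe #-}
-- Shortest paths of Q_h have the Hamming distance as length, so every vertex of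
-- I(u,w) differs from u only in coordinates where w does. A neighbour of u in M
-- flips a coordinate that w flips, hence lies in the raised cube. Conversely, if
-- z ∈ I(u,w) ∩ M were not in N[u], the second vertex v of an M-free shortest
-- u,z-path is a neighbour of u flipping a coordinate i in which z, hence w,
-- differs from u. By the choice of w some vertex of N(u) ∩ M flips i, and that
-- vertex can only be v; so v ∈ M, contradicting M-freeness.
module Submission where

open import Defs
open import Data.Bool using (Bool; true; false; not)
open import Data.Bool.Properties using (¬-not) renaming (_≟_ to _≟ᵇ_)
open import Data.Empty using (⊥-elim)
open import Data.Fin using (Fin; zero; suc)
open import Data.Fin.Properties using (_≟_)
open import Data.Nat using (ℕ; suc; _+_; _≤_; z≤n; s≤s)
open import Data.Nat.Properties
  using (≤-refl; ≤-trans; ≤-reflexive; ≤-antisym; +-mono-≤; +-suc; m+n≮n; +-commutativeSemigroup; module ≤-Reasoning)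
open import Algebra.Properties.CommutativeSemigroup +-commutativeSemigroup using (interchange; x∙yz≈y∙xz)
open import Data.Product using (Σ; _×_; _,_; proj₁; proj₂)
open import Data.Sum using (inj₁; inj₂)
open import Data.Vec using ([]; _∷_; lookup; _[_]%=_)
open import Data.Vec.Properties using (lookup∘updateAt; lookup∘updateAt′; tabulate∘lookup; tabulate-cong)
open import Function.Bundles using (_⇔_; mk⇔)
open import Relation.Binary.PropositionalEquality
  using (_≡_; _≢_; refl; sym; trans; cong; subst; ≢-sym)
open import Relation.Nullary using (yes; no; contradiction)

diff : Bool → Bool → ℕ
diff false false = 0
diff true  true  = 0
diff false true  = 1
diff true  false = 1

diff-self : ∀ a → diff a a ≡ 0
diff-self false = refl
diff-self true  = refl

diff-≢ : ∀ {a b} → a ≢ b → diff a b ≡ 1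
diff-≢ {false} {false} a≢b = contradiction refl a≢b
diff-≢ {true}  {true}  a≢b = contradiction refl a≢b
diff-≢ {false} {true}  _   = refl
diff-≢ {true}  {false} _   = refl

diff-triangle : ∀ a b c → diff a c ≤ diff a b + diff b c
diff-triangle false false c     = ≤-refl
diff-triangle true  true  c     = ≤-refl
diff-triangle false true  false = z≤n
diff-triangle false true  true  = s≤s z≤n
diff-triangle true  false false = s≤s z≤n
diff-triangle true  false true  = z≤n

hamming : ∀ {h} → V h → V h → ℕ
hamming []      []      = 0
hamming (a ∷ u) (b ∷ v) = diff a b + hamming u v

hamming-self : ∀ {h} (u : V h) → hamming u u ≡ 0
hamming-self []      = refl
hamming-self (a ∷ u) = trans (cong (_+ hamming u u) (diff-self a)) (hamming-self u)

hamming-triangle : ∀ {h} (u z w : V h) → hamming u w ≤ hamming u z + hamming z w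
hamming-triangle []      []      []      = z≤n
hamming-triangle (a ∷ u) (b ∷ z) (c ∷ w) = begin
  diff a c + hamming u w                             ≤⟨ +-mono-≤ (diff-triangle a b c) (hamming-triangle u z w) ⟩
  (diff a b + diff b c) + (hamming u z + hamming z w) ≡⟨ interchange (diff a b) (diff b c) (hamming u z) (hamming z w) ⟩
  (diff a b + hamming u z) + (diff b c + hamming z w) ∎
  where open ≤-Reasoning

hamming-triangle-strict : ∀ {h} (u z w : V h) (i : Fin h) →
  lookup z i ≢ lookup u i → lookup w i ≡ lookup u i →
  2 + hamming u w ≤ hamming u z + hamming z w
hamming-triangle-strict (a ∷ u) (b ∷ z) (.a ∷ w) zero b≢a refl
  rewrite diff-self a | diff-≢ b≢a | diff-≢ (≢-sym b≢a) =
  s≤s (≤-trans (s≤s (hamming-triangle u z w)) (≤-reflexive (sym (+-suc (hamming u z) (hamming z w)))))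
hamming-triangle-strict (a ∷ u) (b ∷ z) (c ∷ w) (suc i) z≢u w≡u = begin
  2 + (diff a c + hamming u w)                        ≡⟨ x∙yz≈y∙xz 2 (diff a c) (hamming u w) ⟩
  diff a c + (2 + hamming u w)                        ≤⟨ +-mono-≤ (diff-triangle a b c) (hamming-triangle-strict u z w i z≢u w≡u) ⟩
  (diff a b + diff b c) + (hamming u z + hamming z w) ≡⟨ interchange (diff a b) (diff b c) (hamming u z) (hamming z w) ⟩
  (diff a b + hamming u z) + (diff b c + hamming z w) ∎
  where open ≤-Reasoning

flip : ∀ {h} → Fin h → V h → V h
flip i u = u [ i ]%= not

hamming-flip : ∀ {h} (i : Fin h) (u x : V h) → lookup x i ≢ lookup u i →
  hamming u x ≡ suc (hamming (flip i u) x)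
hamming-flip zero    (false ∷ u) (false ∷ x) x≢u = contradiction refl x≢u
hamming-flip zero    (true  ∷ u) (true  ∷ x) x≢u = contradiction refl x≢u
hamming-flip zero    (false ∷ u) (true  ∷ x) _   = refl
hamming-flip zero    (true  ∷ u) (false ∷ x) _   = refl
hamming-flip (suc i) (a ∷ u)     (c ∷ x)     x≢u =
  trans (cong (diff a c +_) (hamming-flip i u x x≢u)) (+-suc (diff a c) _)

lookup-injective : ∀ {h} {u v : V h} → (∀ j → lookup u j ≡ lookup v j) → u ≡ v
lookup-injective {u = u} {v} u≗v =
  trans (sym (tabulate∘lookup u)) (trans (tabulate-cong u≗v) (tabulate∘lookup v))

Adj⇒flip : ∀ {h} {u v : V h} (u~v : Adj u v) → v ≡ flip (proj₁ u~v) u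
Adj⇒flip {u = u} {v} (i , u≢v , agree) = lookup-injective v≗flip
  where
  v≗flip : ∀ j → lookup v j ≡ lookup (flip i u) j
  v≗flip j with j ≟ i
  ... | yes refl = trans (¬-not (≢-sym u≢v)) (sym (lookup∘updateAt i u))
  ... | no j≢i   = trans (sym (agree j j≢i)) (sym (lookup∘updateAt′ j i j≢i u))

Adj-unique : ∀ {h} {u v x : V h} (u~v : Adj u v) → Adj u x →
  lookup x (proj₁ u~v) ≢ lookup u (proj₁ u~v) → x ≡ v
Adj-unique {u = u} {v} {x} u~v@(i , _) u~x@(j , _ , agree) x≢u with j ≟ i
... | yes refl = trans (Adj⇒flip {u = u} {x} u~x) (sym (Adj⇒flip {u = u} {v} u~v))
... | no j≢i   = contradiction (sym (agree i (≢-sym j≢i))) x≢u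

Adj⇒hamming-toward : ∀ {h} {u v x : V h} (u~v : Adj u v) →
  lookup x (proj₁ u~v) ≢ lookup u (proj₁ u~v) → hamming u x ≡ suc (hamming v x)
Adj⇒hamming-toward {u = u} {v} {x} u~v@(i , _) x≢u =
  subst (λ y → hamming u x ≡ suc (hamming y x)) (sym (Adj⇒flip {u = u} {v} u~v)) (hamming-flip i u x x≢u)

Adj⇒hamming≡1 : ∀ {h} {u v : V h} → Adj u v → hamming u v ≡ 1
Adj⇒hamming≡1 {u = u} {v} u~v@(_ , u≢v , _) =
  trans (Adj⇒hamming-toward {u = u} {v} {v} u~v (≢-sym u≢v)) (cong suc (hamming-self v))

hamming≤length : ∀ {h} {u v : V h} (p : Path u v) → hamming u v ≤ length p
hamming≤length {u = u} []                      = ≤-reflexive (hamming-self u)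
hamming≤length {u = u} {w} (_∷_ {v = v} u~v p) = begin
  hamming u w               ≤⟨ hamming-triangle u v w ⟩
  hamming u v + hamming v w ≡⟨ cong (_+ hamming v w) (Adj⇒hamming≡1 {u = u} {v} u~v) ⟩
  suc (hamming v w)         ≤⟨ s≤s (hamming≤length p) ⟩
  suc (length p)            ∎
  where open ≤-Reasoning

Adj-head : ∀ {h} {a b : Bool} (u : V h) → a ≢ b → Adj (a ∷ u) (b ∷ u)
Adj-head u a≢b = zero , a≢b , λ { zero 0≢0 → contradiction refl 0≢0 ; (suc j) _ → refl }

Adj-∷ : ∀ {h} {u v : V h} (b : Bool) → Adj u v → Adj (b ∷ u) (b ∷ v)
Adj-∷ b (i , u≢v , agree) =
  suc i , u≢v , λ { zero _ → refl ; (suc j) j≢i → agree j (λ j≡i → j≢i (cong suc j≡i)) }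

Path-∷ : ∀ {h} {u v : V h} (b : Bool) → Path u v → Path (b ∷ u) (b ∷ v)
Path-∷ b []        = []
Path-∷ b (u~v ∷ p) = Adj-∷ b u~v ∷ Path-∷ b p

length-Path-∷ : ∀ {h} {u v : V h} (b : Bool) (p : Path u v) → length (Path-∷ b p) ≡ length p
length-Path-∷ b []      = refl
length-Path-∷ b (_ ∷ p) = cong suc (length-Path-∷ b p)

geodesic : ∀ {h} (u v : V h) → Σ (Path u v) λ p → length p ≡ hamming u v
geodesic []      []      = [] , refl
geodesic (a ∷ u) (b ∷ v) with geodesic u v | a ≟ᵇ b
... | p , len-p | yes refl rewrite diff-self a =
  Path-∷ a p , trans (length-Path-∷ a p) len-p
... | p , len-p | no a≢b rewrite diff-≢ a≢b =
  Adj-head u a≢b ∷ Path-∷ b p , cong suc (trans (length-Path-∷ b p) len-p)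

Shortest⇒length≡hamming : ∀ {h} {u v : V h} (p : Path u v) → Shortest p → length p ≡ hamming u v
Shortest⇒length≡hamming {u = u} {v} p p-shortest with geodesic u v
... | q , len-q = ≤-antisym (≤-trans (p-shortest q) (≤-reflexive len-q)) (hamming≤length p)

length≡hamming⇒Shortest : ∀ {h} {u v : V h} (p : Path u v) → length p ≡ hamming u v → Shortest p
length≡hamming⇒Shortest p len-p q = ≤-trans (≤-reflexive len-p) (hamming≤length q)

OnPath⇒hamming-detour≤length : ∀ {h} {u w z : V h} (p : Path u w) → OnPath z p →
  hamming u z + hamming z w ≤ length p
OnPath⇒hamming-detour≤length {u = u} {w} p here =
  ≤-trans (≤-reflexive (cong (_+ hamming u w) (hamming-self u))) (hamming≤length p)
OnPath⇒hamming-detour≤length {u = u} {w} {z} (_∷_ {v = v} u~v p) (there z∈p) = begin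
  hamming u z + hamming z w                 ≤⟨ +-mono-≤ (hamming-triangle u v z) ≤-refl ⟩
  (hamming u v + hamming v z) + hamming z w ≡⟨ cong (λ d → (d + hamming v z) + hamming z w) (Adj⇒hamming≡1 {u = u} {v} u~v) ⟩
  suc (hamming v z + hamming z w)           ≤⟨ s≤s (OnPath⇒hamming-detour≤length p z∈p) ⟩
  suc (length p)                            ∎
  where open ≤-Reasoning

Interval-differs : ∀ {h} {u w z : V h} → Interval u w z → (i : Fin h) →
  lookup z i ≢ lookup u i → lookup w i ≢ lookup u i
Interval-differs {u = u} {w} {z} (p , p-shortest , z∈p) i z≢u w≡u = m+n≮n 1 (hamming u w) (begin
  2 + hamming u w           ≤⟨ hamming-triangle-strict u z w i z≢u w≡u ⟩
  hamming u z + hamming z w ≤⟨ OnPath⇒hamming-detour≤length p z∈p ⟩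
  length p                  ≡⟨ Shortest⇒length≡hamming p p-shortest ⟩
  hamming u w               ∎)
  where open ≤-Reasoning

RaisedApex⇒M : ∀ {h} {M : V h → Set} {u v w : V h} → RaisedApex M u w → (u~v : Adj u v) →
  lookup w (proj₁ u~v) ≢ lookup u (proj₁ u~v) → M v
RaisedApex⇒M {M = M} {u} {v} raised u~v@(i , _) w≢u with proj₁ (raised i) w≢u
... | x , u~x , Mx , x≢u = subst M (Adj-unique {u = u} {v} {x} u~v u~x x≢u) Mx

Interval∩M⊆ClosedNbr : ∀ {h} {M : V h → Set} {u w z : V h} →
  MutualVisibility M → M u → RaisedApex M u w → Interval u w z → M z → ClosedNbr u z
Interval∩M⊆ClosedNbr {M = M} {u} {w} {z} visible Mu raised z∈I Mz with visible u z Mu Mz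
... | [] , _ , _ = inj₁ refl
... | (u~z ∷ []) , _ , _ = inj₂ u~z
... | (_∷_ {v = v} u~v q@(_ ∷ _)) , shortest , free = ⊥-elim (free v (there here) v≢u v≢z Mv)
  where
  i : Fin _
  i = proj₁ u~v
  v≢u : v ≢ u
  v≢u refl = proj₁ (proj₂ u~v) refl
  v≢z : v ≢ z
  v≢z refl with shortest (u~v ∷ [])
  ... | s≤s ()
  z≢u : lookup z i ≢ lookup u i
  z≢u = Interval-differs (u~v ∷ q , shortest , there here) i (≢-sym (proj₁ (proj₂ u~v)))
  Mv : M v
  Mv = RaisedApex⇒M {u = u} {v} {w} raised u~v (Interval-differs z∈I i z≢u)

ClosedNbr∩M⊆Interval : ∀ {h} {M : V h → Set} {u w z : V h} →
  RaisedApex M u w → ClosedNbr u z → M z → Interval u w z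
ClosedNbr∩M⊆Interval {u = u} {w} _ (inj₁ refl) _ with geodesic u w
... | p , len-p = p , length≡hamming⇒Shortest p len-p , here
ClosedNbr∩M⊆Interval {u = u} {w} {z} raised (inj₂ u~z@(i , u≢z , _)) Mz with geodesic z w
... | p , len-p = u~z ∷ p , length≡hamming⇒Shortest (u~z ∷ p) len , there here
  where
  w≢u : lookup w i ≢ lookup u i
  w≢u = proj₂ (raised i) (z , u~z , Mz , ≢-sym u≢z)
  len : suc (length p) ≡ hamming u w
  len = trans (cong suc len-p) (sym (Adj⇒hamming-toward {u = u} {z} {w} u~z w≢u))

proposition3p4 : ∀ (h : ℕ) (M : V h → Set) (u w : V h) →
    MutualVisibility M → M u → RaisedApex M u w →
    ∀ (z : V h) → (Interval u w z × M z) ⇔ (ClosedNbr u z × M z)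
proposition3p4 h M u w visible Mu raised z = mk⇔
  (λ (z∈I , Mz) → Interval∩M⊆ClosedNbr visible Mu raised z∈I Mz , Mz)
  (λ (z∈N , Mz) → ClosedNbr∩M⊆Interval raised z∈N Mz , Mz)
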